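{- Let $t$ be an $\mathrm{SL}_2$-tiling and let $i\le j$ and $p\le q$ be integers such that $(i,p)\neq(j,q)$ and $t_{jp}=t_{iq}=1$. Then there is a friese on the diagonal band $D=\{(x,y)\in\mathbb{Z}^2: i-q\le x-y\le j-p\}$ which agrees with $t$ on the rectangle $R=\{(x,y)\in\mathbb{Z}^2: i\le x\le j,\ p\le y\le q\}$.
   Context: An $\mathrm{SL}_2$-tiling is a map $t:\mathbb{Z}\times\mathbb{Z}\to\{1,2,3,\dots\}$, $(i,j)\mapsto t_{ij}$, with $t_{ij}t_{i+1,j+1}-t_{i,j+1}t_{i+1,j}=1$ for all $i,j$. For $E\subseteq\mathbb{Z}^2$, a partial $\mathrm{SL}_2$-tiling on $E$ is a map $E\to\{1,2,3,\dots\}$ satisfying the same determinant condition whenever all four points $(i,j),(i,j+1),(i+1,j),(i+1,j+1)$ lie in $E$. For integers $m<M$, a friese on the band $\{(x,y): m\le x-y\le M\}$ is a partial $\mathrm{SL}_2$-tiling on that band whose value is $1$ at every point with $x-y=m$ or $x-y=M$. -}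

module Defs where

open import Data.Nat using (ℕ; _*_; _≤_) renaming (_+_ to _+ℕ_)
open import Data.Integer using (ℤ; _+_; _-_; 1ℤ) renaming (_≤_ to _≤ℤ_)
open import Data.Product using (_×_)
open import Relation.Binary.PropositionalEquality using (_≡_)

-- Determinant condition t_{ij} t_{i+1,j+1} - t_{i,j+1} t_{i+1,j} = 1,
-- stated in ℕ (equivalent since all values are natural numbers).
DetOne : (ℤ → ℤ → ℕ) → ℤ → ℤ → Set
DetOne t i j = t i j * t (i + 1ℤ) (j + 1ℤ) ≡ t i (j + 1ℤ) * t (i + 1ℤ) j +ℕ 1

IsSL2Tiling : (ℤ → ℤ → ℕ) → Set
IsSL2Tiling t = (∀ i j → 1 ≤ t i j) × (∀ i j → DetOne t i j)

InBand : ℤ → ℤ → ℤ → ℤ → Set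
InBand m M x y = (m ≤ℤ x - y) × (x - y ≤ℤ M)

-- A partial SL2-tiling on the band, represented by a total function whose
-- values outside the band are ignored.
IsPartialSL2TilingOnBand : ℤ → ℤ → (ℤ → ℤ → ℕ) → Set
IsPartialSL2TilingOnBand m M f =
  (∀ x y → InBand m M x y → 1 ≤ f x y) ×
  (∀ x y → InBand m M x y → InBand m M x (y + 1ℤ) →
           InBand m M (x + 1ℤ) y → InBand m M (x + 1ℤ) (y + 1ℤ) →
           DetOne f x y)

IsFrieseOnBand : ℤ → ℤ → (ℤ → ℤ → ℕ) → Set
IsFrieseOnBand m M f =
  IsPartialSL2TilingOnBand m M f ×
  (∀ x y → x - y ≡ m → f x y ≡ 1) ×
  (∀ x y → x - y ≡ M → f x y ≡ 1)

module Submission where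

-- Write j = i + A and q = p + B.  The rows  row x = (t x p , t x (p+1))  and suitable dual
-- columns  dual y  (built from the 2×2 block of t at (i , p)) satisfy  t x y = det (row x) (dual y)
-- for x ≥ i, y ≥ p: both sides obey the determinant relation and agree on row i and column p.
-- The vectors  row i , … , row j , dual p , … , dual q  form a unimodular cycle of length
-- n = A + B + 2: consecutive determinants are 1 (at the junction this is t j p = 1), the closing
-- determinant is t i q = 1, and all determinants det (v a) (v b) with a < b are positive, because a
-- unimodular sequence of vectors with positive first coordinates turns monotonically.  Extending
-- the cycle antiperiodically gives a unimodular sequence C with positive determinants at distances
-- 1 … n-1; by the Plücker relation the values ∣det (C a) (C b)∣ then form a friese of width n - 2,
-- which on the rectangle reproduces det (row x) (dual y) = t x y.

open import Defs
open import Data.Nat as ℕ using (ℕ; zero; suc; z≤n; s≤s)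
import Data.Nat.Properties as ℕ
open import Data.Integer as ℤ using (ℤ; +_; -[1+_]; _+_; _*_; -_; _-_; _<_; ∣_∣; 0ℤ; 1ℤ; -1ℤ; +<+; _/ℕ_; _%ℕ_) renaming (_≤_ to _≤ℤ_)
import Data.Integer.Properties as ℤ
import Data.Integer.DivMod as ℤ
open import Data.Integer.Tactic.RingSolver using (solve-∀)
open import Data.Product using (Σ; _×_; _,_; proj₁)
open import Data.Empty using (⊥-elim)
open import Data.Sum using (inj₁; inj₂)
open import Relation.Binary.Definitions using (tri<; tri≈; tri>)
open import Relation.Binary.PropositionalEquality
open import Relation.Nullary using (¬_; yes; no)

≤⇒offset : ∀ {a b} → a ≤ℤ b → Σ ℕ (λ k → b ≡ a + + k)
≤⇒offset {a} {b} a≤b = ∣ a - b ∣ , trans (split a b) (cong (λ m → a + m) (sym (ℤ.∣-∣-≤ a≤b)))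
  where
  split : ∀ a b → b ≡ a + (b - a)
  split = solve-∀

+-offsets : ∀ z a b → z + + (a ℕ.+ b) ≡ (z + + a) + + b
+-offsets z a b = trans (cong (λ m → z + m) (ℤ.pos-+ a b)) (sym (ℤ.+-assoc z (+ a) (+ b)))

+-offset-suc : ∀ z k → z + + suc k ≡ (z + + k) + 1ℤ
+-offset-suc z k = trans (cong (λ m → z + + m) (ℕ.+-comm 1 k)) (+-offsets z k 1)

+-cancelʳ : ∀ {a b} c → a + c ≡ b + c → a ≡ b
+-cancelʳ {a} {b} c eq = trans (undo a c) (trans (cong (_- c) eq) (sym (undo b c)))
  where
  undo : ∀ a c → a ≡ (a + c) - c
  undo = solve-∀

offset-≤ : ∀ z a k → z + + a ≤ℤ z + + k → a ℕ.≤ k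
offset-≤ z a k le = ℤ.drop‿+≤+ (begin
  + a            ≡⟨ back z (+ a) ⟩
  z + + a - z    ≤⟨ ℤ.+-monoˡ-≤ (- z) le ⟩
  z + + k - z    ≡⟨ sym (back z (+ k)) ⟩
  + k            ∎)
  where
  open ℤ.≤-Reasoning
  back : ∀ z m → m ≡ z + m - z
  back = solve-∀

pos*pos : ∀ {a b} → 0ℤ < a → 0ℤ < b → 0ℤ < a * b
pos*pos {a} {b} 0<a 0<b =
  subst (_< a * b) (ℤ.*-zeroʳ a) (ℤ.*-monoˡ-<-pos a {{ℤ.positive 0<a}} 0<b)

pos-factor : ∀ {a b} → 0ℤ < a → 0ℤ < a * b → 0ℤ < b
pos-factor {a} {b} 0<a 0<ab =
  ℤ.*-cancelˡ-<-nonNeg a {{ℤ.nonNegative (ℤ.<⇒≤ 0<a)}} (subst (_< a * b) (sym (ℤ.*-zeroʳ a)) 0<ab)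

pos⇒1≤∣∣ : ∀ {a} → 0ℤ < a → 1 ℕ.≤ ∣ a ∣
pos⇒1≤∣∣ (+<+ 0<n) = 0<n

V2 : Set
V2 = ℤ × ℤ

det : V2 → V2 → ℤ
det (a , b) (c , d) = a * d - b * c

_·v_ : ℤ → V2 → V2
k ·v (a , b) = (k * a , k * b)

plucker : ∀ x y z w → det x z * det y w - det x w * det y z ≡ det x y * det z w
plucker (a , b) (c , d) (e , f) (g , h) = identity a b c d e f g h
  where
  identity : ∀ a b c d e f g h →
    (a * f - b * e) * (c * h - d * g) - (a * h - b * g) * (c * f - d * e) ≡ (a * d - b * c) * (e * h - f * g)
  identity = solve-∀

det-expansion : ∀ x y z → proj₁ x * det y z ≡ proj₁ y * det x z - proj₁ z * det x y
det-expansion (a , b) (c , d) (e , f) = identity a b c d e f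
  where
  identity : ∀ a b c d e f → a * (c * f - d * e) ≡ c * (a * f - b * e) - e * (a * d - b * c)
  identity = solve-∀

det-antisym : ∀ x y → det x y ≡ - det y x
det-antisym (a , b) (c , d) = identity a b c d
  where
  identity : ∀ a b c d → a * d - b * c ≡ - (c * b - d * a)
  identity = solve-∀

det-self : ∀ x → det x x ≡ 0ℤ
det-self (a , b) = identity a b
  where
  identity : ∀ a b → a * b - b * a ≡ 0ℤ
  identity = solve-∀

det-negʳ : ∀ x y → det x (-1ℤ ·v y) ≡ det y x
det-negʳ (a , b) (c , d) = identity a b c d
  where
  identity : ∀ a b c d → a * (-1ℤ * d) - b * (-1ℤ * c) ≡ c * b - d * a
  identity = solve-∀

UnimodularAt : (ℤ → ℤ → ℤ) → ℤ → ℤ → Set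
UnimodularAt g x y = g x y * g (x + 1ℤ) (y + 1ℤ) - g x (y + 1ℤ) * g (x + 1ℤ) y ≡ 1ℤ

toℤ : (ℤ → ℤ → ℕ) → ℤ → ℤ → ℤ
toℤ f x y = + f x y

detOne⇒unimodularAt : ∀ f x y → DetOne f x y → UnimodularAt (toℤ f) x y
detOne⇒unimodularAt f x y d = begin
  + a * + b - + c * + e      ≡⟨ cong₂ _-_ (sym (ℤ.pos-* a b)) (sym (ℤ.pos-* c e)) ⟩
  + (a ℕ.* b) - + (c ℕ.* e)  ≡⟨ cong (λ m → + m - + (c ℕ.* e)) d ⟩
  + (c ℕ.* e ℕ.+ 1) - + (c ℕ.* e) ≡⟨ cong (_- + (c ℕ.* e)) (ℤ.pos-+ (c ℕ.* e) 1) ⟩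
  + (c ℕ.* e) + 1ℤ - + (c ℕ.* e) ≡⟨ cancel (+ (c ℕ.* e)) ⟩
  1ℤ ∎
  where
  open ≡-Reasoning
  a b c e : ℕ
  a = f x y
  b = f (x + 1ℤ) (y + 1ℤ)
  c = f x (y + 1ℤ)
  e = f (x + 1ℤ) y
  cancel : ∀ m → m + 1ℤ - m ≡ 1ℤ
  cancel = solve-∀

unimodularAt⇒detOne : ∀ f x y → UnimodularAt (toℤ f) x y → DetOne f x y
unimodularAt⇒detOne f x y u = ℤ.+-injective (begin
  + (a ℕ.* b)               ≡⟨ ℤ.pos-* a b ⟩
  + a * + b                 ≡⟨ regroup (+ a * + b) (+ c * + e) ⟩
  (+ a * + b - + c * + e) + + c * + e ≡⟨ cong (_+ + c * + e) u ⟩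
  1ℤ + + c * + e            ≡⟨ ℤ.+-comm 1ℤ (+ c * + e) ⟩
  + c * + e + 1ℤ            ≡⟨ cong (_+ 1ℤ) (sym (ℤ.pos-* c e)) ⟩
  + (c ℕ.* e) + 1ℤ          ≡⟨ sym (ℤ.pos-+ (c ℕ.* e) 1) ⟩
  + (c ℕ.* e ℕ.+ 1)         ∎)
  where
  open ≡-Reasoning
  a b c e : ℕ
  a = f x y
  b = f (x + 1ℤ) (y + 1ℤ)
  c = f x (y + 1ℤ)
  e = f (x + 1ℤ) y
  regroup : ∀ m k → m ≡ (m - k) + k
  regroup = solve-∀

det-array-unimodular : (U V : ℤ → V2) →
  (∀ x → det (U x) (U (x + 1ℤ)) ≡ 1ℤ) → (∀ y → det (V y) (V (y + 1ℤ)) ≡ 1ℤ) →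
  ∀ x y → UnimodularAt (λ x y → det (U x) (V y)) x y
det-array-unimodular U V U-unimodular V-unimodular x y =
  trans (plucker (U x) (U (x + 1ℤ)) (V y) (V (y + 1ℤ)))
        (cong₂ _*_ (U-unimodular x) (V-unimodular y))

minor-determines : ∀ (g h : ℤ → ℤ → ℤ) x y → UnimodularAt g x y → UnimodularAt h x y → h x y ≢ 0ℤ →
  g x y ≡ h x y → g x (y + 1ℤ) ≡ h x (y + 1ℤ) → g (x + 1ℤ) y ≡ h (x + 1ℤ) y →
  g (x + 1ℤ) (y + 1ℤ) ≡ h (x + 1ℤ) (y + 1ℤ)
minor-determines g h x y ug uh h≢0 e₀₀ e₀₁ e₁₀ =
  ℤ.*-cancelˡ-≡ (h x y) _ _ {{ℤ.≢-nonZero h≢0}} (+-cancelʳ (- (h x (y + 1ℤ) * h (x + 1ℤ) y)) (begin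
    h x y * g (x + 1ℤ) (y + 1ℤ) - h x (y + 1ℤ) * h (x + 1ℤ) y
      ≡⟨ cong₂ (λ a b → a * g (x + 1ℤ) (y + 1ℤ) - b) (sym e₀₀) (sym (cong₂ _*_ e₀₁ e₁₀)) ⟩
    g x y * g (x + 1ℤ) (y + 1ℤ) - g x (y + 1ℤ) * g (x + 1ℤ) y
      ≡⟨ trans ug (sym uh) ⟩
    h x y * h (x + 1ℤ) (y + 1ℤ) - h x (y + 1ℤ) * h (x + 1ℤ) y ∎))
  where open ≡-Reasoning

unimodular-agree : ∀ (g h : ℤ → ℤ → ℤ) x₀ y₀ →
  (∀ x y → UnimodularAt g x y) → (∀ x y → UnimodularAt h x y) → (∀ x y → h x y ≢ 0ℤ) →
  (∀ y → g x₀ y ≡ h x₀ y) → (∀ x → g x y₀ ≡ h x y₀) →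
  ∀ a b → g (x₀ + + a) (y₀ + + b) ≡ h (x₀ + + a) (y₀ + + b)
unimodular-agree g h x₀ y₀ ug uh h≢0 onRow onColumn = agree
  where
  Agree : ℤ → ℤ → Set
  Agree x y = g x y ≡ h x y

  agree : ∀ a b → Agree (x₀ + + a) (y₀ + + b)
  agree zero b = subst (λ x → Agree x (y₀ + + b)) (sym (ℤ.+-identityʳ x₀)) (onRow _)
  agree (suc a) zero = subst (Agree (x₀ + + suc a)) (sym (ℤ.+-identityʳ y₀)) (onColumn _)
  agree (suc a) (suc b) =
    subst₂ Agree (sym (+-offset-suc x₀ a)) (sym (+-offset-suc y₀ b))
      (minor-determines g h x y (ug x y) (uh x y) (h≢0 x y) (agree a b)
        (subst (Agree x) (+-offset-suc y₀ b) (agree a (suc b)))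
        (subst (λ x′ → Agree x′ y) (+-offset-suc x₀ a) (agree (suc a) b)))
    where
    x y : ℤ
    x = x₀ + + a
    y = y₀ + + b

-- Induction on y - x: writing w₁ for the
-- first coordinate, w₁ y · det (w x) (w (y+1)) = w₁ x · 1 + w₁ (y+1) · det (w x) (w y) > 0.
unimodular-turns : (w : ℤ → V2) → (∀ x → 0ℤ < proj₁ (w x)) → (∀ x → det (w x) (w (x + 1ℤ)) ≡ 1ℤ) →
  ∀ x y → x < y → 0ℤ < det (w x) (w y)
unimodular-turns w first-pos unimodular x y x<y with ≤⇒offset (ℤ.i<j⇒suc[i]≤j x<y)
... | d , refl = subst (λ z → 0ℤ < det (w x) (w z)) (reindex x d) (turns d)
  where
  reindex : ∀ x d → x + + suc d ≡ (1ℤ + x) + + d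
  reindex x d = trans (cong (λ m → x + m) (ℤ.pos-+ 1 d)) (shuffle x (+ d))
    where
    shuffle : ∀ x m → x + (1ℤ + m) ≡ (1ℤ + x) + m
    shuffle = solve-∀

  turns : ∀ d → 0ℤ < det (w x) (w (x + + suc d))
  turns zero = subst (0ℤ <_) (sym (unimodular x)) (+<+ (s≤s z≤n))
  turns (suc d) = subst (λ z → 0ℤ < det (w x) (w z)) (sym (+-offset-suc x (suc d)))
    (pos-factor (first-pos y′) (subst (0ℤ <_) (sym expansion)
      (ℤ.+-mono-< (subst (0ℤ <_) (sym (ℤ.*-identityʳ _)) (first-pos x))
               (pos*pos (first-pos (y′ + 1ℤ)) (turns d)))))
    where
    y′ : ℤ
    y′ = x + + suc d
    expansion : proj₁ (w y′) * det (w x) (w (y′ + 1ℤ))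
              ≡ proj₁ (w x) * 1ℤ + proj₁ (w (y′ + 1ℤ)) * det (w x) (w y′)
    expansion = begin
      proj₁ (w y′) * det (w x) (w (y′ + 1ℤ))
        ≡⟨ det-expansion (w y′) (w x) (w (y′ + 1ℤ)) ⟩
      proj₁ (w x) * det (w y′) (w (y′ + 1ℤ)) - proj₁ (w (y′ + 1ℤ)) * det (w y′) (w x)
        ≡⟨ cong₂ (λ a b → proj₁ (w x) * a - proj₁ (w (y′ + 1ℤ)) * b)
                 (unimodular y′) (det-antisym (w y′) (w x)) ⟩
      proj₁ (w x) * 1ℤ - proj₁ (w (y′ + 1ℤ)) * - det (w x) (w y′)
        ≡⟨ neg-neg (proj₁ (w x) * 1ℤ) (proj₁ (w (y′ + 1ℤ))) (det (w x) (w y′)) ⟩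
      proj₁ (w x) * 1ℤ + proj₁ (w (y′ + 1ℤ)) * det (w x) (w y′) ∎
      where
      open ≡-Reasoning
      neg-neg : ∀ a b c → a - b * - c ≡ a + b * c
      neg-neg = solve-∀

alternating : ℕ → ℤ
alternating zero = 1ℤ
alternating (suc k) = - alternating k

sign : ℤ → ℤ
sign (+ k) = alternating k
sign -[1+ k ] = alternating (suc k)

sign-suc : ∀ k → sign (k + 1ℤ) ≡ - sign k
sign-suc (+ k) = cong alternating (ℕ.+-comm k 1)
sign-suc -[1+ zero ] = refl
sign-suc -[1+ suc k ] = sym (ℤ.neg-involutive _)

sign-square : ∀ k → sign k * sign k ≡ 1ℤ
sign-square (+ k) = alternating-square k
  where
  alternating-square : ∀ k → alternating k * alternating k ≡ 1ℤ
  alternating-square zero = refl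
  alternating-square (suc k) = trans (neg-square (alternating k)) (alternating-square k)
    where
    neg-square : ∀ a → - a * - a ≡ a * a
    neg-square = solve-∀
sign-square -[1+ k ] = sign-square (+ suc k)

det-same-sign : ∀ k x y → det (sign k ·v x) (sign k ·v y) ≡ det x y
det-same-sign k (a , b) (c , d) =
  trans (identity (sign k) a b c d) (trans (cong (_* det (a , b) (c , d)) (sign-square k)) (ℤ.*-identityˡ _))
  where
  identity : ∀ s a b c d → s * a * (s * d) - s * b * (s * c) ≡ s * s * (a * d - b * c)
  identity = solve-∀

det-next-sign : ∀ k x y → det (sign k ·v x) (sign (k + 1ℤ) ·v y) ≡ det y x
det-next-sign k (a , b) (c , d) rewrite sign-suc k =
  trans (identity (sign k) a b c d) (trans (cong (_* det (c , d) (a , b)) (sign-square k)) (ℤ.*-identityˡ _))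
  where
  identity : ∀ s a b c d → s * a * (- s * d) - s * b * (- s * c) ≡ s * s * (c * b - d * a)
  identity = solve-∀

module AntiperiodicExtension (n : ℕ) .{{_ : ℕ.NonZero n}} where

  below-next-multiple : ∀ r r′ k k′ → r ℕ.< n → k < k′ → + r + k * + n < + r′ + k′ * + n
  below-next-multiple r r′ k k′ r<n k<k′ = begin-strict
    + r + k * + n          <⟨ ℤ.+-monoˡ-< (k * + n) (+<+ r<n) ⟩
    + n + k * + n          ≡⟨ next k (+ n) ⟩
    (1ℤ + k) * + n         ≤⟨ ℤ.*-monoʳ-≤-nonNeg (+ n) (ℤ.i<j⇒suc[i]≤j k<k′) ⟩
    k′ * + n               ≤⟨ ℤ.i≤j+i (k′ * + n) (+ r′) ⟩
    + r′ + k′ * + n        ∎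
    where
    open ℤ.≤-Reasoning
    next : ∀ k m → m + k * m ≡ (1ℤ + k) * m
    next = solve-∀

  quotient-unique : ∀ r r′ k k′ → r ℕ.< n → r′ ℕ.< n → + r + k * + n ≡ + r′ + k′ * + n → k ≡ k′
  quotient-unique r r′ k k′ r<n r′<n eq with ℤ.<-cmp k k′
  ... | tri< k<k′ _ _ = ⊥-elim (ℤ.<⇒≢ (below-next-multiple r r′ k k′ r<n k<k′) eq)
  ... | tri≈ _ k≡k′ _ = k≡k′
  ... | tri> _ _ k′<k = ⊥-elim (ℤ.<⇒≢ (below-next-multiple r′ r k′ k r′<n k′<k) (sym eq))

  divmod-unique : ∀ r k → r ℕ.< n → ((+ r + k * + n) %ℕ n ≡ r) × ((+ r + k * + n) /ℕ n ≡ k)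
  divmod-unique r k r<n = remainder , quotient
    where
    z : ℤ
    z = + r + k * + n
    decomposition : + (z %ℕ n) + (z /ℕ n) * + n ≡ z
    decomposition = sym (ℤ.a≡a%ℕn+[a/ℕn]*n z n)
    quotient : z /ℕ n ≡ k
    quotient = quotient-unique (z %ℕ n) r (z /ℕ n) k (ℤ.n%ℕd<d z n) r<n decomposition
    remainder : z %ℕ n ≡ r
    remainder = ℤ.+-injective (+-cancelʳ (k * + n)
      (trans (cong (λ q → + (z %ℕ n) + q * + n) (sym quotient)) decomposition))

  module _ (v : ℕ → V2) where

    ext : ℤ → V2
    ext z = sign (z /ℕ n) ·v v (z %ℕ n)

    ext-at : ∀ r k → r ℕ.< n → ext (+ r + k * + n) ≡ sign k ·v v r
    ext-at r k r<n with divmod-unique r k r<n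
    ... | remainder , quotient = cong₂ (λ k r → sign k ·v v r) quotient remainder

    ext-window : ∀ s → s ℕ.< n → ext (+ s) ≡ v s
    ext-window s s<n = trans (cong ext (no-multiple (+ s) (+ n))) (trans (ext-at s 0ℤ s<n) (one (v s)))
      where
      no-multiple : ∀ a m → a ≡ a + 0ℤ * m
      no-multiple = solve-∀
      one : ∀ x → 1ℤ ·v x ≡ x
      one (a , b) = cong₂ _,_ (ℤ.*-identityˡ a) (ℤ.*-identityˡ b)

    shifted : ∀ z e → z + + e ≡ + (z %ℕ n ℕ.+ e) + (z /ℕ n) * + n
    shifted z e = begin
      z + + e                              ≡⟨ cong (_+ + e) (ℤ.a≡a%ℕn+[a/ℕn]*n z n) ⟩
      + (z %ℕ n) + (z /ℕ n) * + n + + e     ≡⟨ swap (+ (z %ℕ n)) ((z /ℕ n) * + n) (+ e) ⟩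
      + (z %ℕ n) + + e + (z /ℕ n) * + n     ≡⟨ cong (_+ (z /ℕ n) * + n) (sym (ℤ.pos-+ (z %ℕ n) e)) ⟩
      + (z %ℕ n ℕ.+ e) + (z /ℕ n) * + n     ∎
      where
      open ≡-Reasoning
      swap : ∀ a b c → a + b + c ≡ a + c + b
      swap = solve-∀

    wrapped : ∀ z e r′ → r′ ℕ.+ n ≡ z %ℕ n ℕ.+ e → z + + e ≡ + r′ + (z /ℕ n + 1ℤ) * + n
    wrapped z e r′ wrap = begin
      z + + e                               ≡⟨ shifted z e ⟩
      + (z %ℕ n ℕ.+ e) + (z /ℕ n) * + n     ≡⟨ cong (λ m → + m + (z /ℕ n) * + n) (sym wrap) ⟩
      + (r′ ℕ.+ n) + (z /ℕ n) * + n         ≡⟨ cong (_+ (z /ℕ n) * + n) (ℤ.pos-+ r′ n) ⟩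
      + r′ + + n + (z /ℕ n) * + n           ≡⟨ carry (+ r′) (+ n) (z /ℕ n) ⟩
      + r′ + (z /ℕ n + 1ℤ) * + n            ∎
      where
      open ≡-Reasoning
      carry : ∀ a m k → a + m + k * m ≡ a + (k + 1ℤ) * m
      carry = solve-∀

    det-ext-within : ∀ z e → z %ℕ n ℕ.+ e ℕ.< n →
      det (ext z) (ext (z + + e)) ≡ det (v (z %ℕ n)) (v (z %ℕ n ℕ.+ e))
    det-ext-within z e inside = begin
      det (ext z) (ext (z + + e))
        ≡⟨ cong (det (ext z)) (trans (cong ext (shifted z e)) (ext-at _ (z /ℕ n) inside)) ⟩
      det (sign (z /ℕ n) ·v v (z %ℕ n)) (sign (z /ℕ n) ·v v (z %ℕ n ℕ.+ e))
        ≡⟨ det-same-sign (z /ℕ n) _ _ ⟩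
      det (v (z %ℕ n)) (v (z %ℕ n ℕ.+ e)) ∎
      where open ≡-Reasoning

    det-ext-across : ∀ z e r′ → r′ ℕ.< n → r′ ℕ.+ n ≡ z %ℕ n ℕ.+ e →
      det (ext z) (ext (z + + e)) ≡ det (v r′) (v (z %ℕ n))
    det-ext-across z e r′ r′<n wrap = begin
      det (ext z) (ext (z + + e))
        ≡⟨ cong (det (ext z)) (trans (cong ext (wrapped z e r′ wrap)) (ext-at r′ (z /ℕ n + 1ℤ) r′<n)) ⟩
      det (sign (z /ℕ n) ·v v (z %ℕ n)) (sign (z /ℕ n + 1ℤ) ·v v r′)
        ≡⟨ det-next-sign (z /ℕ n) _ _ ⟩
      det (v r′) (v (z %ℕ n)) ∎
      where open ≡-Reasoning

    ext-antiperiodic : ∀ z → ext (z + + n) ≡ -1ℤ ·v ext z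
    ext-antiperiodic z = begin
      ext (z + + n)
        ≡⟨ cong ext (wrapped z n (z %ℕ n) refl) ⟩
      ext (+ (z %ℕ n) + (z /ℕ n + 1ℤ) * + n)
        ≡⟨ ext-at (z %ℕ n) (z /ℕ n + 1ℤ) (ℤ.n%ℕd<d z n) ⟩
      sign (z /ℕ n + 1ℤ) ·v v (z %ℕ n)
        ≡⟨ cong (_·v v (z %ℕ n)) (sign-suc (z /ℕ n)) ⟩
      (- sign (z /ℕ n)) ·v v (z %ℕ n)
        ≡⟨ negate (sign (z /ℕ n)) (v (z %ℕ n)) ⟩
      -1ℤ ·v ext z ∎
      where
      open ≡-Reasoning
      negate : ∀ s x → (- s) ·v x ≡ -1ℤ ·v (s ·v x)
      negate s (a , b) = cong₂ _,_ (identity s a) (identity s b)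
        where
        identity : ∀ s a → - s * a ≡ -1ℤ * (s * a)
        identity = solve-∀

    ext-unimodular : (∀ s → suc s ℕ.< n → det (v s) (v (suc s)) ≡ 1ℤ) →
      det (v 0) (v (ℕ.pred n)) ≡ 1ℤ → ∀ z → det (ext z) (ext (z + 1ℤ)) ≡ 1ℤ
    ext-unimodular consecutive closing z with suc (z %ℕ n) ℕ.<? n
    ... | yes inside =
      trans (det-ext-within z 1 (subst (ℕ._< n) (ℕ.+-comm 1 r) inside))
            (trans (cong (λ s → det (v r) (v s)) (ℕ.+-comm r 1)) (consecutive r inside))
      where
      r : ℕ
      r = z %ℕ n
    ... | no outside =
      trans (det-ext-across z 1 0 (ℕ.>-nonZero⁻¹ n) (trans (sym last) (ℕ.+-comm 1 r)))
            (subst (λ s → det (v 0) (v s) ≡ 1ℤ) (sym (cong ℕ.pred last)) closing)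
      where
      r : ℕ
      r = z %ℕ n
      last : suc r ≡ n
      last = ℕ.≤-antisym (ℤ.n%ℕd<d z n) (ℕ.≮⇒≥ outside)

    ext-positive : (∀ a b → a ℕ.< b → b ℕ.< n → 0ℤ < det (v a) (v b)) →
      ∀ z e → 0 ℕ.< e → e ℕ.< n → 0ℤ < det (ext z) (ext (z + + e))
    ext-positive positive z e 0<e e<n with z %ℕ n ℕ.+ e ℕ.<? n
    ... | yes inside =
      subst (0ℤ <_) (sym (det-ext-within z e inside)) (positive r (r ℕ.+ e) (ℕ.m<m+n r 0<e) inside)
      where
      r : ℕ
      r = z %ℕ n
    ... | no outside =
      subst (0ℤ <_) (sym (det-ext-across z e r′ (ℕ.<-trans r′<r r<n) wrap)) (positive r′ r r′<r r<n)
      where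
      r : ℕ
      r = z %ℕ n
      r<n : r ℕ.< n
      r<n = ℤ.n%ℕd<d z n
      r′ : ℕ
      r′ = r ℕ.+ e ℕ.∸ n
      wrap : r′ ℕ.+ n ≡ r ℕ.+ e
      wrap = ℕ.m∸n+n≡m (ℕ.≮⇒≥ outside)
      r′<r : r′ ℕ.< r
      r′<r = ℕ.+-cancelʳ-< n r′ r (subst (ℕ._< r ℕ.+ n) (sym wrap) (ℕ.+-monoʳ-< r e<n))

module FrieseFromSequence (w : ℕ) (C : ℤ → V2)
  (C-unimodular : ∀ z → det (C z) (C (z + 1ℤ)) ≡ 1ℤ)
  (C-antiperiodic : ∀ z → C (z + + (2 ℕ.+ w)) ≡ -1ℤ ·v C z)
  (C-positive : ∀ z e → 0 ℕ.< e → e ℕ.< 2 ℕ.+ w → 0ℤ < det (C z) (C (z + + e)))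
  (c M : ℤ) where

  column : ℤ → ℤ
  column y = y - c + (M + 1ℤ)

  F : ℤ → ℤ → ℤ
  F x y = det (C (x - c)) (C (column y))

  friese : ℤ → ℤ → ℕ
  friese x y = ∣ F x y ∣

  column-gap : ∀ x y → column y ≡ (x - c) + (M - (x - y)) + 1ℤ
  column-gap x y = identity x y c M
    where
    identity : ∀ x y c M → y - c + (M + 1ℤ) ≡ (x - c) + (M - (x - y)) + 1ℤ
    identity = solve-∀

  band-gap : ∀ x y → InBand (M - + w) M x y → Σ ℕ (λ k → (k ℕ.≤ w) × (column y ≡ (x - c) + + suc k))
  band-gap x y (lower , upper) with ≤⇒offset lower | ≤⇒offset upper
  ... | l , x-y≡ | k , M≡ = k , k≤w , gap
    where
    gap : column y ≡ (x - c) + + suc k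
    gap = begin
      column y                        ≡⟨ column-gap x y ⟩
      (x - c) + (M - (x - y)) + 1ℤ    ≡⟨ cong (λ m → (x - c) + (m - (x - y)) + 1ℤ) M≡ ⟩
      (x - c) + ((x - y) + + k - (x - y)) + 1ℤ ≡⟨ identity (x - c) (x - y) (+ k) ⟩
      (x - c) + (1ℤ + + k)            ≡⟨ cong (λ m → (x - c) + m) (sym (ℤ.pos-+ 1 k)) ⟩
      (x - c) + + suc k               ∎
      where
      open ≡-Reasoning
      identity : ∀ a d k → a + (d + k - d) + 1ℤ ≡ a + (1ℤ + k)
      identity = solve-∀
    widths : + (l ℕ.+ k) ≡ + w
    widths = begin
      + (l ℕ.+ k)                     ≡⟨ ℤ.pos-+ l k ⟩
      + l + + k                       ≡⟨ identity (+ l) (+ k) M (+ w) ⟩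
      (M - + w + + l) + + k - M + + w ≡⟨ cong (λ m → m + + k - M + + w) (sym x-y≡) ⟩
      (x - y) + + k - M + + w         ≡⟨ cong (λ m → m - M + + w) (sym M≡) ⟩
      M - M + + w                     ≡⟨ cancel M (+ w) ⟩
      + w                             ∎
      where
      open ≡-Reasoning
      identity : ∀ l k M w → l + k ≡ (M - w + l) + k - M + w
      identity = solve-∀
      cancel : ∀ M w → M - M + w ≡ w
      cancel = solve-∀
    k≤w : k ℕ.≤ w
    k≤w = subst (k ℕ.≤_) (ℤ.+-injective widths) (ℕ.m≤n+m k l)

  F-positive : ∀ x y → InBand (M - + w) M x y → 0ℤ < F x y
  F-positive x y band with band-gap x y band
  ... | k , k≤w , gap = subst (λ z → 0ℤ < det (C (x - c)) (C z)) (sym gap)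
                          (C-positive (x - c) (suc k) (s≤s z≤n) (s≤s (s≤s k≤w)))

  F-unimodular : ∀ x y → UnimodularAt F x y
  F-unimodular = det-array-unimodular (λ x → C (x - c)) (λ y → C (column y))
    (λ x → subst (λ z → det (C (x - c)) (C z) ≡ 1ℤ) (sym (step-row x)) (C-unimodular (x - c)))
    (λ y → subst (λ z → det (C (column y)) (C z) ≡ 1ℤ) (sym (step-column y)) (C-unimodular (column y)))
    where
    step-row : ∀ x → (x + 1ℤ) - c ≡ (x - c) + 1ℤ
    step-row x = identity x c
      where
      identity : ∀ x c → (x + 1ℤ) - c ≡ (x - c) + 1ℤ
      identity = solve-∀
    step-column : ∀ y → column (y + 1ℤ) ≡ column y + 1ℤ
    step-column y = identity y c M
      where
      identity : ∀ y c M → (y + 1ℤ) - c + (M + 1ℤ) ≡ y - c + (M + 1ℤ) + 1ℤ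
      identity = solve-∀

  friese-detOne : ∀ x y → InBand (M - + w) M x y → InBand (M - + w) M x (y + 1ℤ) →
    InBand (M - + w) M (x + 1ℤ) y → InBand (M - + w) M (x + 1ℤ) (y + 1ℤ) → DetOne friese x y
  friese-detOne x y b₀₀ b₀₁ b₁₀ b₁₁ = unimodularAt⇒detOne friese x y (begin
    + friese x y * + friese (x + 1ℤ) (y + 1ℤ) - + friese x (y + 1ℤ) * + friese (x + 1ℤ) y
      ≡⟨ cong₂ (λ a b → a * b - + friese x (y + 1ℤ) * + friese (x + 1ℤ) y) (abs x y b₀₀) (abs (x + 1ℤ) (y + 1ℤ) b₁₁) ⟩
    F x y * F (x + 1ℤ) (y + 1ℤ) - + friese x (y + 1ℤ) * + friese (x + 1ℤ) y
      ≡⟨ cong₂ (λ a b → F x y * F (x + 1ℤ) (y + 1ℤ) - a * b) (abs x (y + 1ℤ) b₀₁) (abs (x + 1ℤ) y b₁₀) ⟩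
    F x y * F (x + 1ℤ) (y + 1ℤ) - F x (y + 1ℤ) * F (x + 1ℤ) y
      ≡⟨ F-unimodular x y ⟩
    1ℤ ∎)
    where
    open ≡-Reasoning
    abs : ∀ x y → InBand (M - + w) M x y → + friese x y ≡ F x y
    abs x y band = ℤ.0≤i⇒+∣i∣≡i (ℤ.<⇒≤ (F-positive x y band))

  -- On the top diagonal the indices are adjacent.
  friese-top : ∀ x y → x - y ≡ M → friese x y ≡ 1
  friese-top x y top = cong ∣_∣ (trans (cong (λ z → det (C (x - c)) (C z)) adjacent) (C-unimodular (x - c)))
    where
    adjacent : column y ≡ (x - c) + 1ℤ
    adjacent = trans (column-gap x y) (trans (cong (λ d → (x - c) + (M - d) + 1ℤ) top) (identity (x - c) M))
      where
      identity : ∀ a M → a + (M - M) + 1ℤ ≡ a + 1ℤ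
      identity = solve-∀

  -- On the bottom diagonal the indices are n - 1 apart, and antiperiodicity closes the cycle.
  friese-bottom : ∀ x y → x - y ≡ M - + w → friese x y ≡ 1
  friese-bottom x y bottom = cong ∣_∣ (begin
    det (C a) (C (column y))                ≡⟨ cong (λ z → det (C a) (C z)) wrap ⟩
    det (C a) (C ((a - 1ℤ) + + (2 ℕ.+ w)))  ≡⟨ cong (det (C a)) (C-antiperiodic (a - 1ℤ)) ⟩
    det (C a) (-1ℤ ·v C (a - 1ℤ))           ≡⟨ det-negʳ (C a) (C (a - 1ℤ)) ⟩
    det (C (a - 1ℤ)) (C a)                  ≡⟨ cong (λ z → det (C (a - 1ℤ)) (C z)) (back a) ⟩
    det (C (a - 1ℤ)) (C ((a - 1ℤ) + 1ℤ))    ≡⟨ C-unimodular (a - 1ℤ) ⟩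
    1ℤ                                      ∎)
    where
    open ≡-Reasoning
    a : ℤ
    a = x - c
    back : ∀ a → a ≡ (a - 1ℤ) + 1ℤ
    back = solve-∀
    wrap : column y ≡ (a - 1ℤ) + + (2 ℕ.+ w)
    wrap = begin
      column y                              ≡⟨ column-gap x y ⟩
      a + (M - (x - y)) + 1ℤ                ≡⟨ cong (λ d → a + (M - d) + 1ℤ) bottom ⟩
      a + (M - (M - + w)) + 1ℤ              ≡⟨ identity a M (+ w) ⟩
      (a - 1ℤ) + (1ℤ + (1ℤ + + w))          ≡⟨ cong (λ m → (a - 1ℤ) + (1ℤ + m)) (sym (ℤ.pos-+ 1 w)) ⟩
      (a - 1ℤ) + (1ℤ + + (1 ℕ.+ w))         ≡⟨ cong (λ m → (a - 1ℤ) + m) (sym (ℤ.pos-+ 1 (1 ℕ.+ w))) ⟩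
      (a - 1ℤ) + + (2 ℕ.+ w)                ∎
      where
      identity : ∀ a M w → a + (M - (M - w)) + 1ℤ ≡ (a - 1ℤ) + (1ℤ + (1ℤ + w))
      identity = solve-∀

  friese-isFriese : IsFrieseOnBand (M - + w) M friese
  friese-isFriese =
    ((λ x y band → pos⇒1≤∣∣ (F-positive x y band)) , friese-detOne) , friese-bottom , friese-top

-- Rows  row x = (t x p , t x (p+1))  and dual columns  dual y, built from the columns
-- col y = (t i y , t (i+1) y)  through the block at (i , p), so that t x y = det (row x) (dual y)
-- south-east of (i , p).
module TilingVectors (t : ℤ → ℤ → ℕ) (t-pos : ∀ x y → 1 ℕ.≤ t x y) (t-det : ∀ x y → DetOne t x y)
  (i p : ℤ) where

  row : ℤ → V2
  row x = (+ t x p , + t x (p + 1ℤ))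

  col : ℤ → V2
  col y = (+ t i y , + t (i + 1ℤ) y)

  dual : ℤ → V2
  dual y = (det (col y) (col p) , det (col y) (col (p + 1ℤ)))

  row-unimodular : ∀ x → det (row x) (row (x + 1ℤ)) ≡ 1ℤ
  row-unimodular x = detOne⇒unimodularAt t x p (t-det x p)

  col-unimodular : ∀ y → det (col y) (col (y + 1ℤ)) ≡ 1ℤ
  col-unimodular y =
    trans (cong (λ m → + t i y * + t (i + 1ℤ) (y + 1ℤ) - m) (ℤ.*-comm (+ t (i + 1ℤ) y) (+ t i (y + 1ℤ))))
          (detOne⇒unimodularAt t i y (t-det i y))

  -- Passing to dual columns preserves determinants, since det (col p) (col (p+1)) = 1.
  det-dual : ∀ y y′ → det (dual y) (dual y′) ≡ det (col y) (col y′)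
  det-dual y y′ =
    trans (plucker (col y) (col y′) (col p) (col (p + 1ℤ)))
          (trans (cong (det (col y) (col y′) *_) (col-unimodular p)) (ℤ.*-identityʳ _))

  dual-unimodular : ∀ y → det (dual y) (dual (y + 1ℤ)) ≡ 1ℤ
  dual-unimodular y = trans (det-dual y (y + 1ℤ)) (col-unimodular y)

  on-row : ∀ y → det (row i) (dual y) ≡ + t i y
  on-row y = begin
    det (row i) (dual y)
      ≡⟨ sym (det-expansion (col y) (col p) (col (p + 1ℤ))) ⟩
    + t i y * det (col p) (col (p + 1ℤ))  ≡⟨ cong (+ t i y *_) (col-unimodular p) ⟩
    + t i y * 1ℤ                          ≡⟨ ℤ.*-identityʳ _ ⟩
    + t i y                               ∎
    where open ≡-Reasoning

  on-column : ∀ x → det (row x) (dual p) ≡ + t x p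
  on-column x = begin
    det (row x) (dual p)
      ≡⟨ cong₂ (λ a b → + t x p * a - + t x (p + 1ℤ) * b) (col-unimodular p) (det-self (col p)) ⟩
    + t x p * 1ℤ - + t x (p + 1ℤ) * 0ℤ  ≡⟨ identity (+ t x p) (+ t x (p + 1ℤ)) ⟩
    + t x p                             ∎
    where
    open ≡-Reasoning
    identity : ∀ a b → a * 1ℤ - b * 0ℤ ≡ a
    identity = solve-∀

  representation : ∀ a b → det (row (i + + a)) (dual (p + + b)) ≡ + t (i + + a) (p + + b)
  representation = unimodular-agree (λ x y → det (row x) (dual y)) (toℤ t) i p
    (det-array-unimodular row dual row-unimodular dual-unimodular)
    (λ x y → detOne⇒unimodularAt t x y (t-det x y))
    (λ x y eq → ℤ.<⇒≢ (+<+ (t-pos x y)) (sym eq))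
    on-row on-column

  -- Rows and dual columns turn monotonically, since entries of t are positive.
  row-turns : ∀ x x′ → x < x′ → 0ℤ < det (row x) (row x′)
  row-turns = unimodular-turns row (λ x → +<+ (t-pos x p)) row-unimodular

  dual-turns : ∀ y y′ → y < y′ → 0ℤ < det (dual y) (dual y′)
  dual-turns y y′ y<y′ =
    subst (0ℤ <_) (sym (det-dual y y′)) (unimodular-turns col (λ y → +<+ (t-pos i y)) col-unimodular y y′ y<y′)

module RectangleCycle (t : ℤ → ℤ → ℕ) (t-pos : ∀ x y → 1 ℕ.≤ t x y) (t-det : ∀ x y → DetOne t x y)
  (i p : ℤ) (A B : ℕ) (corner : t (i + + A) p ≡ 1) (opposite : t i (p + + B) ≡ 1) where

  open TilingVectors t t-pos t-det i p

  vertex : ℕ → V2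
  vertex s with s ℕ.≤? A
  ... | yes _ = row (i + + s)
  ... | no _ = dual (p + + (s ℕ.∸ suc A))

  vertex-row : ∀ a → a ℕ.≤ A → vertex a ≡ row (i + + a)
  vertex-row a a≤A with a ℕ.≤? A
  ... | yes _ = refl
  ... | no a≰A = ⊥-elim (a≰A a≤A)

  vertex-dual : ∀ b → vertex (suc A ℕ.+ b) ≡ dual (p + + b)
  vertex-dual b with suc A ℕ.+ b ℕ.≤? A
  ... | yes beyond = ⊥-elim (ℕ.<⇒≱ (ℕ.m≤m+n (suc A) b) beyond)
  ... | no _ = cong (λ s → dual (p + + s)) (ℕ.m+n∸m≡n (suc A) b)

  data Side : ℕ → Set where
    rowSide : ∀ {a} → a ℕ.≤ A → Side a
    dualSide : ∀ b → Side (suc A ℕ.+ b)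

  side : ∀ s → Side s
  side s with s ℕ.≤? A
  ... | yes s≤A = rowSide s≤A
  ... | no s≰A = subst Side (ℕ.m+[n∸m]≡n (ℕ.≰⇒> s≰A)) (dualSide (s ℕ.∸ suc A))

  -- Consecutive determinants are 1; at the junction this is t (i + A) p = 1.
  vertex-unimodular : ∀ s → det (vertex s) (vertex (suc s)) ≡ 1ℤ
  vertex-unimodular s with side s
  vertex-unimodular s | rowSide s≤A with ℕ.m≤n⇒m<n∨m≡n s≤A
  ... | inj₁ s<A = begin
    det (vertex s) (vertex (suc s))         ≡⟨ cong₂ det (vertex-row s s≤A) (vertex-row (suc s) s<A) ⟩
    det (row (i + + s)) (row (i + + suc s)) ≡⟨ cong (λ x → det (row (i + + s)) (row x)) (+-offset-suc i s) ⟩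
    det (row (i + + s)) (row ((i + + s) + 1ℤ)) ≡⟨ row-unimodular (i + + s) ⟩
    1ℤ                                      ∎
    where open ≡-Reasoning
  ... | inj₂ refl = begin
    det (vertex A) (vertex (suc A))
      ≡⟨ cong₂ det (vertex-row A ℕ.≤-refl) (trans (cong vertex (sym (ℕ.+-identityʳ (suc A)))) (vertex-dual 0)) ⟩
    det (row (i + + A)) (dual (p + + 0))    ≡⟨ representation A 0 ⟩
    + t (i + + A) (p + + 0)                 ≡⟨ cong (λ y → + t (i + + A) y) (ℤ.+-identityʳ p) ⟩
    + t (i + + A) p                         ≡⟨ cong +_ corner ⟩
    1ℤ                                      ∎
    where open ≡-Reasoning
  vertex-unimodular _ | dualSide b = begin
    det (vertex (suc A ℕ.+ b)) (vertex (suc (suc A ℕ.+ b)))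
      ≡⟨ cong₂ det (vertex-dual b) (trans (cong vertex (sym (ℕ.+-suc (suc A) b))) (vertex-dual (suc b))) ⟩
    det (dual (p + + b)) (dual (p + + suc b))    ≡⟨ cong (λ y → det (dual (p + + b)) (dual y)) (+-offset-suc p b) ⟩
    det (dual (p + + b)) (dual ((p + + b) + 1ℤ)) ≡⟨ dual-unimodular (p + + b) ⟩
    1ℤ                                           ∎
    where open ≡-Reasoning

  vertex-closing : det (vertex 0) (vertex (suc (A ℕ.+ B))) ≡ 1ℤ
  vertex-closing = begin
    det (vertex 0) (vertex (suc (A ℕ.+ B))) ≡⟨ cong₂ det (vertex-row 0 z≤n) (vertex-dual B) ⟩
    det (row (i + + 0)) (dual (p + + B))    ≡⟨ representation 0 B ⟩
    + t (i + + 0) (p + + B)                 ≡⟨ cong (λ x → + t x (p + + B)) (ℤ.+-identityʳ i) ⟩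
    + t i (p + + B)                         ≡⟨ cong +_ opposite ⟩
    1ℤ                                      ∎
    where open ≡-Reasoning

  -- Determinants along the cycle are positive: rows and dual columns turn monotonically, and a
  -- row against a dual column is an entry of t.
  vertex-positive : ∀ a b → a ℕ.< b → 0ℤ < det (vertex a) (vertex b)
  vertex-positive a b a<b with side a | side b
  ... | rowSide a≤A | rowSide b≤A =
    subst (0ℤ <_) (sym (cong₂ det (vertex-row a a≤A) (vertex-row b b≤A)))
      (row-turns (i + + a) (i + + b) (ℤ.+-monoʳ-< i (+<+ a<b)))
  ... | rowSide a≤A | dualSide b′ =
    subst (0ℤ <_) (sym (trans (cong₂ det (vertex-row a a≤A) (vertex-dual b′)) (representation a b′)))
      (+<+ (t-pos (i + + a) (p + + b′)))
  ... | dualSide a′ | rowSide b≤A = ⊥-elim (ℕ.<⇒≱ (ℕ.<-trans (ℕ.m≤m+n (suc A) a′) a<b) b≤A)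
  ... | dualSide a′ | dualSide b′ =
    subst (0ℤ <_) (sym (cong₂ det (vertex-dual a′) (vertex-dual b′)))
      (dual-turns (p + + a′) (p + + b′) (ℤ.+-monoʳ-< p (+<+ (ℕ.+-cancelˡ-< (suc A) a′ b′ a<b))))

  n : ℕ
  n = 2 ℕ.+ (A ℕ.+ B)

  open AntiperiodicExtension n

  C : ℤ → V2
  C = ext vertex

  open FrieseFromSequence (A ℕ.+ B) C
    (ext-unimodular vertex (λ s _ → vertex-unimodular s) vertex-closing)
    (ext-antiperiodic vertex)
    (ext-positive vertex (λ a b a<b _ → vertex-positive a b a<b))
    i ((i + + A) - p)
    public

  friese-agrees : ∀ a b → a ℕ.≤ A → b ℕ.≤ B → friese (i + + a) (p + + b) ≡ t (i + + a) (p + + b)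
  friese-agrees a b a≤A b≤B = cong ∣_∣ (begin
    det (C ((i + + a) - i)) (C (column (p + + b)))
      ≡⟨ cong₂ (λ x y → det (C x) (C y)) (rebase i (+ a)) first-dual ⟩
    det (C (+ a)) (C (+ (suc A ℕ.+ b)))
      ≡⟨ cong₂ det (ext-window vertex a a<n) (ext-window vertex (suc A ℕ.+ b) A+1+b<n) ⟩
    det (vertex a) (vertex (suc A ℕ.+ b))
      ≡⟨ cong₂ det (vertex-row a a≤A) (vertex-dual b) ⟩
    det (row (i + + a)) (dual (p + + b))
      ≡⟨ representation a b ⟩
    + t (i + + a) (p + + b) ∎)
    where
    open ≡-Reasoning
    rebase : ∀ i a → (i + a) - i ≡ a
    rebase = solve-∀
    a<n : a ℕ.< n
    a<n = s≤s (ℕ.≤-trans a≤A (ℕ.≤-trans (ℕ.m≤m+n A B) (ℕ.n≤1+n _)))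
    A+1+b<n : suc A ℕ.+ b ℕ.< n
    A+1+b<n = s≤s (s≤s (ℕ.+-monoʳ-≤ A b≤B))
    first-dual : column (p + + b) ≡ + (suc A ℕ.+ b)
    first-dual = begin
      (p + + b) - i + ((i + + A) - p + 1ℤ) ≡⟨ identity p i (+ A) (+ b) ⟩
      (1ℤ + + A) + + b                    ≡⟨ sym (ℤ.pos-+ (suc A) b) ⟩
      + (suc A ℕ.+ b)                     ∎
      where
      identity : ∀ p i A b → (p + b) - i + ((i + A) - p + 1ℤ) ≡ (1ℤ + A) + b
      identity = solve-∀

band-nonempty : ∀ i p A B → ¬ ((i ≡ i + + A) × (p ≡ p + + B)) → i - (p + + B) < (i + + A) - p
band-nonempty i p A B not-point =
  subst₂ _<_ (ℤ.+-identityʳ lower) widen (ℤ.+-monoʳ-< lower (+<+ (width-positive A B not-point)))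
  where
  lower : ℤ
  lower = i - (p + + B)
  width-positive : ∀ A B → ¬ ((i ≡ i + + A) × (p ≡ p + + B)) → 0 ℕ.< A ℕ.+ B
  width-positive zero zero not-point = ⊥-elim (not-point (sym (ℤ.+-identityʳ i) , sym (ℤ.+-identityʳ p)))
  width-positive zero (suc B) _ = s≤s z≤n
  width-positive (suc A) B _ = s≤s z≤n
  widen : lower + + (A ℕ.+ B) ≡ (i + + A) - p
  widen = trans (cong (λ m → lower + m) (ℤ.pos-+ A B)) (identity i p (+ A) (+ B))
    where
    identity : ∀ i p A B → i - (p + B) + (A + B) ≡ (i + A) - p
    identity = solve-∀

band-bottom : ∀ i p A B → ((i + + A) - p) - + (A ℕ.+ B) ≡ i - (p + + B)
band-bottom i p A B = trans (cong (λ m → ((i + + A) - p) - m) (ℤ.pos-+ A B)) (identity i p (+ A) (+ B))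
  where
  identity : ∀ i p A B → ((i + A) - p) - (A + B) ≡ i - (p + B)
  identity = solve-∀

proposition7p2 : (t : ℤ → ℤ → ℕ) → IsSL2Tiling t →
    (i j p q : ℤ) → i ≤ℤ j → p ≤ℤ q → ¬ ((i ≡ j) × (p ≡ q)) →
    t j p ≡ 1 → t i q ≡ 1 →
    (i - q < j - p) ×
    Σ (ℤ → ℤ → ℕ) (λ f → IsFrieseOnBand (i - q) (j - p) f ×
      (∀ x y → i ≤ℤ x → x ≤ℤ j → p ≤ℤ y → y ≤ℤ q → f x y ≡ t x y))
proposition7p2 t (t-pos , t-det) i j p q i≤j p≤q not-point corner opposite
  with ≤⇒offset i≤j | ≤⇒offset p≤q
... | A , refl | B , refl =
  band-nonempty i p A B not-point ,
  friese ,
  subst (λ m → IsFrieseOnBand m ((i + + A) - p) friese) (band-bottom i p A B) friese-isFriese ,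
  agreement
  where
  open RectangleCycle t t-pos t-det i p A B corner opposite

  agreement : ∀ x y → i ≤ℤ x → x ≤ℤ i + + A → p ≤ℤ y → y ≤ℤ p + + B → friese x y ≡ t x y
  agreement x y i≤x x≤j p≤y y≤q with ≤⇒offset i≤x | ≤⇒offset p≤y
  ... | a , refl | b , refl = friese-agrees a b (offset-≤ i a A x≤j) (offset-≤ p b B y≤q)
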